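{- Let $n\ge 2$ and $k\ge 0$ be integers and let $G$ be a simple graph of order $n$ with complement $\bar G$. Then $$\alpha_{k-reg}(G)+\alpha_{k-reg}(\bar G)=3 \quad\text{or}\quad \alpha_{k-reg}(G)\cdot\alpha_{k-reg}(\bar G)=2$$ holds if and only if all of the following hold: (1) $k=0$; (2) for every integer $i\ge 0$, $|D_i(G)|\le 2$ and $|D_i(\bar G)|\le 2$; (3) either $G[D_i(G)]$ is connected for every $i$ with $D_i(G)\neq\emptyset$, or $\bar G[D_j(\bar G)]$ is connected for every $j$ with $D_j(\bar G)\ne\emptyset$.
   Context: All graphs are finite, simple and undirected. For a graph $G$ and an integer $i\ge 0$, $D_i(G)$ denotes the set of vertices of degree $i$ in $G$, and $G[X]$ is the subgraph induced by $X$. For an integer $k\ge 0$, a set $S\subseteq V(G)$ is $k$-independent if $G[S]$ has maximum degree at most $k$. A regular $k$-independent set is a $k$-independent set $S$ with $S\subseteq D_i(G)$ for some $i$. The regular $k$-independence number $\alpha_{k-reg}(G)$ is the maximum cardinality of a regular $k$-independent set of $G$. -}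

module Defs where

open import Data.Nat using (ℕ; zero; suc; _+_; _*_; _≤_)
open import Data.Nat.Properties using () renaming (_≟_ to _≟ℕ_)
open import Data.Bool using (Bool; true; false; not; if_then_else_)
open import Data.Fin using (Fin)
open import Data.Fin.Properties using (_≟_)
open import Data.Fin.Subset using (Subset; _∈_; ∣_∣)
open import Data.List using (List; map; allFin)
open import Data.Nat.ListAction using (sum)
open import Data.Vec using (tabulate)
open import Data.Product using (Σ; ∃; _×_; _,_)
open import Relation.Nullary using (yes; no; ¬_)
open import Relation.Nullary.Decidable using (⌊_⌋)
open import Relation.Binary.PropositionalEquality using (_≡_; refl; sym)
open import Data.Empty using (⊥-elim)

record Graph (n : ℕ) : Set where
  field
    adj    : Fin n → Fin n → Bool
    adj-sym : ∀ u v → adj u v ≡ adj v u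
    adj-irrefl : ∀ v → adj v v ≡ false
open Graph public

complement : ∀ {n} → Graph n → Graph n
complement {n} G = record { adj = a ; adj-sym = s ; adj-irrefl = r }
  where
  a : Fin n → Fin n → Bool
  a u v with u ≟ v
  ... | yes _ = false
  ... | no _  = not (adj G u v)
  s : ∀ u v → a u v ≡ a v u
  s u v with u ≟ v | v ≟ u
  ... | yes _ | yes _ = refl
  ... | yes p | no q = ⊥-elim (q (sym p))
  ... | no p | yes q = ⊥-elim (p (sym q))
  ... | no _ | no _ rewrite adj-sym G u v = refl
  r : ∀ v → a v v ≡ false
  r v with v ≟ v
  ... | yes _ = refl
  ... | no p = ⊥-elim (p refl)

b2n : Bool → ℕ
b2n true = 1
b2n false = 0

degree : ∀ {n} → Graph n → Fin n → ℕ
degree {n} G v = sum (map (λ u → b2n (adj G v u)) (allFin n))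

degreeIn : ∀ {n} → Graph n → Subset n → Fin n → ℕ
degreeIn {n} G S v =
  sum (map (λ u → if Data.Vec.lookup S u then b2n (adj G v u) else 0) (allFin n))

D : ∀ {n} → ℕ → Graph n → Subset n
D i G = tabulate (λ v → ⌊ degree G v ≟ℕ i ⌋)

KIndependent : ∀ {n} → ℕ → Graph n → Subset n → Set
KIndependent k G S = ∀ v → v ∈ S → degreeIn G S v ≤ k

RegularKIndependent : ∀ {n} → ℕ → Graph n → Subset n → Set
RegularKIndependent k G S =
  KIndependent k G S × Σ ℕ (λ i → ∀ v → v ∈ S → v ∈ D i G)

IsAlphaKReg : ∀ {n} → ℕ → Graph n → ℕ → Set
IsAlphaKReg k G a =
  Σ (Subset _) (λ S → RegularKIndependent k G S × ∣ S ∣ ≡ a)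
  × (∀ S → RegularKIndependent k G S → ∣ S ∣ ≤ a)

data WalkIn {n} (G : Graph n) (X : Subset n) : Fin n → Fin n → Set where
  here : ∀ {u} → u ∈ X → WalkIn G X u u
  step : ∀ {u w v} → u ∈ X → adj G u w ≡ true → WalkIn G X w v → WalkIn G X u v

InducedConnected : ∀ {n} → Graph n → Subset n → Set
InducedConnected G X = ∀ u v → u ∈ X → v ∈ X → WalkIn G X u v

-- Any graph on n ≥ 2 vertices has two distinct vertices of equal degree, and they also have
-- equal degree in the complement Ḡ.  Such a pair is 1-independent in both graphs and independent
-- in one of them, so k ≥ 1 forces α(G), α(Ḡ) ≥ 2; as both are positive, the condition on the sum
-- or product means {α(G), α(Ḡ)} = {1, 2}.  Now α(G) = 1 says exactly that every degree class of
-- G is a clique, hence a regular independent set of Ḡ; these classes and those of Ḡ then have at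
-- most α(Ḡ) = 2 vertices.  Conversely, a class of at most two vertices is connected iff it is a
-- clique, and cliques as classes of G force α(G) = 1 and, through an equal-degree pair, α(Ḡ) = 2.
module Submission where

open import Defs
open import Data.Nat using (ℕ; zero; suc; _+_; _*_; _∸_; _≤_; _<_; z≤n; s≤s; >-nonZero)
open import Data.Nat.Properties
  using (+-0-commutativeMonoid; ≤-refl; ≤-trans; ≤-reflexive; ≤-antisym; <⇒≢; <⇒≱; n<1+n; m≤m+n;
         +-mono-≤; *-mono-≤; suc-injective; m+n∸m≡n; n≢0⇒n>0; pred-mono-<;
         pred-injective; module ≤-Reasoning)
  renaming (_≟_ to _≟ℕ_)
open import Algebra.Properties.CommutativeMonoid.Sum +-0-commutativeMonoid
  using (sum-syntax; ∑-distrib-+; sum-remove; sum-cong-≗)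
import Data.Nat.ListAction as ListAction
open import Data.Bool using (true; false; not; if_then_else_)
open import Data.Bool.Properties using (not-involutive; T-≡)
open import Data.Fin using (Fin; zero; suc; toℕ; fromℕ<; punchIn)
open import Data.Fin.Properties using (_≟_; any?; pigeonhole; toℕ-fromℕ<; punchInᵢ≢i) renaming (<⇒≢ to <⇒≢ᶠ)
open import Data.Fin.Subset using (Subset; _∈_; _∪_; ⁅_⁆; ∣_∣; ⊥)
open import Data.Fin.Subset.Properties
  using (x∈⁅x⁆; x∈⁅y⁆⇒x≡y; ∣⁅x⁆∣≡1; ∣⊥∣≡0; x∈p∪q⁺; x∈p∪q⁻; ∪-comm; p⊆q⇒∣p∣≤∣q∣;
         x∈p⇒∣p-x∣<∣p∣; x∈p∧x≢y⇒x∈p-y; nonempty?; Empty-unique)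
open import Data.List using (map; allFin)
open import Data.List.Properties using (map-tabulate)
open import Data.Vec using ([]; _∷_; lookup)
open import Data.Vec.Properties using ([]=⇒lookup; lookup⇒[]=; lookup∘tabulate)
open import Data.Product using (∃; ∃₂; _×_; _,_; proj₁; proj₂; swap)
open import Data.Sum using (_⊎_; inj₁; inj₂)
import Data.Sum as Sum
open import Function using (_∘_; id)
open import Function.Bundles using (_⇔_; mk⇔; Equivalence)
open import Relation.Nullary using (yes; no; contradiction)
open import Relation.Nullary.Decidable using (fromWitness)
open import Relation.Binary.PropositionalEquality

private
  variable
    n m k a : ℕ
    G : Graph n
    S : Subset n
    u w x y z : Fin n

∑-mono-≤ : ∀ {n} {g h : Fin n → ℕ} → (∀ u → g u ≤ h u) → ∑[ u < n ] g u ≤ ∑[ u < n ] h u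
∑-mono-≤ {zero}  _   = z≤n
∑-mono-≤ {suc n} g≤h = +-mono-≤ (g≤h zero) (∑-mono-≤ (g≤h ∘ suc))

∑-const-1 : ∀ n → ∑[ u < n ] 1 ≡ n
∑-const-1 zero    = refl
∑-const-1 (suc n) = cong suc (∑-const-1 n)

≤-∑ : ∀ {n} (h : Fin n → ℕ) v → h v ≤ ∑[ u < n ] h u
≤-∑ {suc n} h v = ≤-trans (m≤m+n (h v) _) (≤-reflexive (sym (sum-remove {i = v} h)))

sum-map-allFin : ∀ {n} (h : Fin n → ℕ) → ListAction.sum (map h (allFin n)) ≡ ∑[ u < n ] h u
sum-map-allFin {zero}  h = refl
sum-map-allFin {suc n} h = cong (h zero +_) (trans
  (cong ListAction.sum (trans (map-tabulate suc h) (sym (map-tabulate id (h ∘ suc)))))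
  (sum-map-allFin (h ∘ suc)))

∣p∣≡∑ : ∀ {n} (p : Subset n) → ∣ p ∣ ≡ ∑[ u < n ] b2n (lookup p u)
∣p∣≡∑ []          = refl
∣p∣≡∑ (true ∷ p)  = cong suc (∣p∣≡∑ p)
∣p∣≡∑ (false ∷ p) = ∣p∣≡∑ p

x∈p⇒0<∣p∣ : x ∈ S → 0 < ∣ S ∣
x∈p⇒0<∣p∣ x∈S = ≤-trans (s≤s z≤n) (x∈p⇒∣p-x∣<∣p∣ x∈S)

distinct-pair⇒2≤∣p∣ : x ∈ S → y ∈ S → x ≢ y → 2 ≤ ∣ S ∣
distinct-pair⇒2≤∣p∣ x∈S y∈S x≢y =
  ≤-trans (s≤s (x∈p⇒0<∣p∣ (x∈p∧x≢y⇒x∈p-y y∈S (x≢y ∘ sym)))) (x∈p⇒∣p-x∣<∣p∣ x∈S)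

distinct-triple⇒3≤∣p∣ : x ∈ S → y ∈ S → z ∈ S → x ≢ y → x ≢ z → y ≢ z → 3 ≤ ∣ S ∣
distinct-triple⇒3≤∣p∣ x∈S y∈S z∈S x≢y x≢z y≢z = ≤-trans
  (s≤s (distinct-pair⇒2≤∣p∣ (x∈p∧x≢y⇒x∈p-y y∈S (x≢y ∘ sym)) (x∈p∧x≢y⇒x∈p-y z∈S (x≢z ∘ sym)) y≢z))
  (x∈p⇒∣p-x∣<∣p∣ x∈S)

subsingleton⇒∣p∣≤1 : ∀ {n} {S : Subset n} → (∀ {x y} → x ∈ S → y ∈ S → x ≡ y) → ∣ S ∣ ≤ 1
subsingleton⇒∣p∣≤1 {n = n} {S = S} unique with nonempty? S
... | yes (x , x∈S) = ≤-trans (p⊆q⇒∣p∣≤∣q∣ (λ y∈S → subst (_∈ ⁅ x ⁆) (unique x∈S y∈S) (x∈⁅x⁆ x)))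
                              (≤-reflexive (∣⁅x⁆∣≡1 x))
... | no  empty     = ≤-trans (≤-reflexive (trans (cong ∣_∣ (Empty-unique empty)) (∣⊥∣≡0 n))) z≤n

∈-pair⁻ : w ∈ ⁅ x ⁆ ∪ ⁅ y ⁆ → w ≡ x ⊎ w ≡ y
∈-pair⁻ {x = x} {y = y} w∈ = Sum.map (x∈⁅y⁆⇒x≡y x) (x∈⁅y⁆⇒x≡y y) (x∈p∪q⁻ ⁅ x ⁆ ⁅ y ⁆ w∈)

x∈pair : x ∈ ⁅ x ⁆ ∪ ⁅ y ⁆
x∈pair {x = x} = x∈p∪q⁺ (inj₁ (x∈⁅x⁆ x))

y∈pair : y ∈ ⁅ x ⁆ ∪ ⁅ y ⁆
y∈pair {y = y} = x∈p∪q⁺ (inj₂ (x∈⁅x⁆ y))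

degree≡∑ : ∀ (G : Graph n) v → degree G v ≡ ∑[ u < n ] b2n (adj G v u)
degree≡∑ G v = sum-map-allFin (λ u → b2n (adj G v u))

∈D⁻ : ∀ {n i} {G : Graph n} {v} → v ∈ D i G → degree G v ≡ i
∈D⁻ {i = i} {G} {v} v∈D with degree G v ≟ℕ i | trans (sym (lookup∘tabulate _ v)) ([]=⇒lookup v∈D)
... | yes dv≡i | _  = dv≡i
... | no  _    | ()

∈D⁺ : ∀ {n i} {G : Graph n} {v} → degree G v ≡ i → v ∈ D i G
∈D⁺ {i = i} {G} {v} dv≡i =
  lookup⇒[]= v _ (trans (lookup∘tabulate _ v) (Equivalence.to T-≡ (fromWitness dv≡i)))

adjacent⇒≢ : ∀ {n} (G : Graph n) {u v} → adj G u v ≡ true → u ≢ v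
adjacent⇒≢ G {u} uv refl = contradiction (trans (sym uv) (adj-irrefl G u)) λ ()

adjacent⇒0<degree : ∀ {n} (G : Graph n) {v u} → adj G v u ≡ true → 0 < degree G v
adjacent⇒0<degree G {v} {u} vu =
  ≤-trans (≤-reflexive (cong b2n (sym vu))) (≤-trans (≤-∑ _ u) (≤-reflexive (sym (degree≡∑ G v))))

degreeIn≤∣∣ : ∀ {n} (G : Graph n) {S T v} →
              (∀ {u} → u ∈ S → adj G v u ≡ true → u ∈ T) → degreeIn G S v ≤ ∣ T ∣
degreeIn≤∣∣ {n} G {S} {T} {v} into = begin
  degreeIn G S v                                           ≡⟨ sum-map-allFin term ⟩
  ∑[ u < n ] term u                                        ≤⟨ ∑-mono-≤ term≤ ⟩
  ∑[ u < n ] b2n (lookup T u)                              ≡⟨ sym (∣p∣≡∑ T) ⟩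
  ∣ T ∣                                                    ∎
  where
  open ≤-Reasoning
  term : Fin n → ℕ
  term u = if lookup S u then b2n (adj G v u) else 0
  term≤ : ∀ u → term u ≤ b2n (lookup T u)
  term≤ u with lookup S u in u∈S | adj G v u in vu
  ... | false | _     = z≤n
  ... | true  | false = z≤n
  ... | true  | true  rewrite []=⇒lookup (into (lookup⇒[]= u S u∈S) vu) = ≤-refl

adjacent-member⇒0<degreeIn : ∀ {n} (G : Graph n) {S u v} → u ∈ S → adj G v u ≡ true → 0 < degreeIn G S v
adjacent-member⇒0<degreeIn {n} G {S} {u} {v} u∈S vu =
  ≤-trans (≤-reflexive term≡1) (≤-trans (≤-∑ term u) (≤-reflexive (sym (sum-map-allFin term))))
  where
  term : Fin n → ℕ
  term w = if lookup S w then b2n (adj G v w) else 0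
  term≡1 : 1 ≡ term u
  term≡1 rewrite []=⇒lookup u∈S | vu = refl

Independent : Graph n → Subset n → Set
Independent G S = ∀ {u v} → u ∈ S → v ∈ S → u ≢ v → adj G u v ≡ false

Independent⇒KIndependent : ∀ {n} {G : Graph n} {S} k → Independent G S → KIndependent k G S
Independent⇒KIndependent {n} {G} k independent v v∈S = ≤-trans
  (degreeIn≤∣∣ G {T = ⊥} λ u∈S vu →
    contradiction (trans (sym vu) (independent v∈S u∈S (adjacent⇒≢ G vu))) λ ())
  (≤-trans (≤-reflexive (∣⊥∣≡0 n)) z≤n)

KIndependent-mono : ∀ {k k′} → k ≤ k′ → KIndependent k G S → KIndependent k′ G S
KIndependent-mono k≤k′ independent v v∈S = ≤-trans (independent v v∈S) k≤k′

nonadjacent-pair-independent : ∀ {G : Graph n} → adj G x y ≡ false → Independent G (⁅ x ⁆ ∪ ⁅ y ⁆)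
nonadjacent-pair-independent {G = G} xy u∈ v∈ u≢v with ∈-pair⁻ u∈ | ∈-pair⁻ v∈
... | inj₁ refl | inj₁ refl = contradiction refl u≢v
... | inj₁ refl | inj₂ refl = xy
... | inj₂ refl | inj₁ refl = trans (adj-sym G _ _) xy
... | inj₂ refl | inj₂ refl = contradiction refl u≢v

neighbour-in-pair : ∀ (G : Graph n) → adj G x u ≡ true → u ∈ ⁅ x ⁆ ∪ ⁅ y ⁆ → u ∈ ⁅ y ⁆
neighbour-in-pair G xu u∈ with ∈-pair⁻ u∈
... | inj₁ refl = contradiction refl (adjacent⇒≢ G xu)
... | inj₂ refl = x∈⁅x⁆ _

pair-1-independent : ∀ (G : Graph n) x y → KIndependent 1 G (⁅ x ⁆ ∪ ⁅ y ⁆)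
pair-1-independent G x y v v∈ with ∈-pair⁻ v∈
... | inj₁ refl = ≤-trans
  (degreeIn≤∣∣ G {T = ⁅ y ⁆} (λ u∈ vu → neighbour-in-pair G vu u∈))
  (≤-reflexive (∣⁅x⁆∣≡1 y))
... | inj₂ refl = ≤-trans
  (degreeIn≤∣∣ G {T = ⁅ x ⁆} (λ u∈ vu → neighbour-in-pair G vu (subst (_ ∈_) (∪-comm ⁅ x ⁆ ⁅ y ⁆) u∈)))
  (≤-reflexive (∣⁅x⁆∣≡1 x))

0<α : ∀ {n k a} → 0 < n → ∀ {G : Graph n} → IsAlphaKReg k G a → 0 < a
0<α {suc n} {k} _ {G} (_ , maximal) = ≤-trans (≤-reflexive (sym (∣⁅x⁆∣≡1 {suc n} zero)))
  (maximal ⁅ zero ⁆ (Independent⇒KIndependent {G = G} k singleton , degree G zero ,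
                     λ v v∈ → ∈D⁺ {G = G} (cong (degree G) (x∈⁅y⁆⇒x≡y zero v∈))))
  where
  singleton : Independent G ⁅ zero ⁆
  singleton u∈ v∈ u≢v = contradiction (trans (x∈⁅y⁆⇒x≡y zero u∈) (sym (x∈⁅y⁆⇒x≡y zero v∈))) u≢v

pair⇒2≤α : ∀ {n k a i} {G : Graph n} {x y} → IsAlphaKReg k G a → KIndependent k G (⁅ x ⁆ ∪ ⁅ y ⁆) →
           x ∈ D i G → y ∈ D i G → x ≢ y → 2 ≤ a
pair⇒2≤α {i = i} {G} {x} {y} (_ , maximal) independent x∈D y∈D x≢y =
  ≤-trans (distinct-pair⇒2≤∣p∣ x∈pair y∈pair x≢y) (maximal _ (independent , i , in-class))
  where
  in-class : ∀ v → v ∈ ⁅ x ⁆ ∪ ⁅ y ⁆ → v ∈ D i G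
  in-class v v∈ with ∈-pair⁻ v∈
  ... | inj₁ refl = x∈D
  ... | inj₂ refl = y∈D

classes≤m⇒α≤m : ∀ {G : Graph n} → (∀ i → ∣ D i G ∣ ≤ m) → IsAlphaKReg k G a → a ≤ m
classes≤m⇒α≤m small ((S , (_ , i , in-class) , refl) , _) =
  ≤-trans (p⊆q⇒∣p∣≤∣q∣ (in-class _)) (small i)

-- Unlike complement, this relation is symmetric, so the lemmas below apply equally with a graph
-- and its complement exchanged.
record Complementary {n} (G H : Graph n) : Set where
  field
    adj-complement : ∀ u v → u ≢ v → adj H u v ≡ not (adj G u v)
open Complementary

complement-complementary : ∀ (G : Graph n) → Complementary G (complement G)
complement-complementary G .adj-complement u v u≢v with u ≟ v
... | yes u≡v = contradiction u≡v u≢v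
... | no  _   = refl

complementary-sym : ∀ {n} {G H : Graph n} → Complementary G H → Complementary H G
complementary-sym {G = G} c .adj-complement u v u≢v =
  trans (sym (not-involutive (adj G u v))) (cong not (sym (c .adj-complement u v u≢v)))

complementary-adj : ∀ {n} {G H : Graph n} → Complementary G H →
                    ∀ {u v} → u ≢ v → adj G u v ≡ true → adj H u v ≡ false
complementary-adj c u≢v uv = trans (c .adj-complement _ _ u≢v) (cong not uv)

b2n-+-not : ∀ x → b2n x + b2n (not x) ≡ 1
b2n-+-not true  = refl
b2n-+-not false = refl

degree-complementary : ∀ {n} {G H : Graph n} → Complementary G H → ∀ v → suc (degree G v + degree H v) ≡ n
degree-complementary {suc m} {G} {H} c v = cong suc (begin
  degree G v + degree H v                   ≡⟨ cong₂ _+_ (degree≡∑ G v) (degree≡∑ H v) ⟩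
  ∑[ u < suc m ] g u + ∑[ u < suc m ] h u   ≡⟨ sym (∑-distrib-+ g h) ⟩
  ∑[ u < suc m ] (g u + h u)                ≡⟨ sum-remove {i = v} (λ u → g u + h u) ⟩
  (g v + h v) + ∑[ j < m ] (g (punchIn v j) + h (punchIn v j))
                                            ≡⟨ cong₂ _+_ loopless (sum-cong-≗ off-diagonal) ⟩
  ∑[ j < m ] 1                              ≡⟨ ∑-const-1 m ⟩
  m                                         ∎)
  where
  open ≡-Reasoning
  g h : Fin (suc m) → ℕ
  g u = b2n (adj G v u)
  h u = b2n (adj H v u)
  loopless : g v + h v ≡ 0
  loopless rewrite adj-irrefl G v | adj-irrefl H v = refl
  off-diagonal : ∀ j → g (punchIn v j) + h (punchIn v j) ≡ 1
  off-diagonal j = trans (cong (λ z → g (punchIn v j) + b2n z) (c .adj-complement v _ (punchInᵢ≢i v j ∘ sym)))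
                         (b2n-+-not (adj G v (punchIn v j)))

∈D-complementary : ∀ {n i v} {G H : Graph n} → Complementary G H → v ∈ D i G → v ∈ D (n ∸ suc i) H
∈D-complementary {n} {i} {v} {G} {H} c v∈ = ∈D⁺ {G = H} (begin
  degree H v                              ≡⟨ sym (m+n∸m≡n (suc i) (degree H v)) ⟩
  suc i + degree H v ∸ suc i              ≡⟨ cong (λ d → suc (d + degree H v) ∸ suc i) (sym (∈D⁻ {G = G} v∈)) ⟩
  suc (degree G v + degree H v) ∸ suc i   ≡⟨ cong (_∸ suc i) (degree-complementary c v) ⟩
  n ∸ suc i                               ∎)
  where open ≡-Reasoning

RepeatedDegree : Graph n → Set
RepeatedDegree G = ∃ λ i → ∃₂ λ u v → u ≢ v × u ∈ D i G × v ∈ D i G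

repeatedDegree-complementary : ∀ {n} {G H : Graph n} → Complementary G H → RepeatedDegree G → RepeatedDegree H
repeatedDegree-complementary c (_ , u , v , u≢v , u∈ , v∈) =
  _ , u , v , u≢v , ∈D-complementary c u∈ , ∈D-complementary c v∈

degree<n : ∀ (G : Graph n) v → degree G v < n
degree<n G v = ≤-trans (s≤s (m≤m+n _ _)) (≤-reflexive (degree-complementary (complement-complementary G) v))

-- Without isolated vertices the n degrees lie in {1, …, n - 1}.
no-isolated⇒repeatedDegree : ∀ {m} (G : Graph (suc m)) → (∀ v → 0 < degree G v) → RepeatedDegree G
no-isolated⇒repeatedDegree {m} G positive =
  let u , v , u<v , same = pigeonhole (n<1+n m) shifted-degree
  in degree G u , u , v , <⇒≢ᶠ u<v , ∈D⁺ {G = G} refl , ∈D⁺ {G = G} (sym (equal same))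
  where
  shifted-degree : Fin (suc m) → Fin m
  shifted-degree w = fromℕ< (pred-mono-< {{>-nonZero (positive w)}} (degree<n G w))
  equal : ∀ {u v} → shifted-degree u ≡ shifted-degree v → degree G u ≡ degree G v
  equal {u} {v} same = pred-injective {{>-nonZero (positive u)}} {{>-nonZero (positive v)}}
    (trans (sym (toℕ-fromℕ< _)) (trans (cong toℕ same) (toℕ-fromℕ< _)))

-- If G has an isolated vertex, its complement has none.
repeatedDegree : 2 ≤ n → (G : Graph n) → RepeatedDegree G
repeatedDegree {suc zero} (s≤s ()) G
repeatedDegree {suc (suc m)} _ G with any? (λ w → degree G w ≟ℕ 0)
... | no  ¬isolated = no-isolated⇒repeatedDegree G (λ v → n≢0⇒n>0 (¬isolated ∘ (v ,_)))
... | yes (w , isolated) = repeatedDegree-complementary (complementary-sym c)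
                             (no-isolated⇒repeatedDegree (complement G) positive)
  where
  c : Complementary G (complement G)
  c = complement-complementary G
  nonadjacent-to-w : ∀ v → adj G v w ≡ false
  nonadjacent-to-w v with adj G w v in wv
  ... | true  = contradiction (subst (0 <_) isolated (adjacent⇒0<degree G wv)) λ ()
  ... | false = trans (adj-sym G v w) wv
  w-codegree : degree (complement G) w ≡ suc m
  w-codegree = suc-injective (trans (cong (λ d → suc (d + degree (complement G) w)) (sym isolated))
                                    (degree-complementary c w))
  positive : ∀ v → 0 < degree (complement G) v
  positive v with v ≟ w
  ... | no v≢w = adjacent⇒0<degree (complement G) {v} {w}
                   (trans (c .adj-complement v w v≢w) (cong not (nonadjacent-to-w v)))
  ... | yes refl = subst (0 <_) (sym w-codegree) (s≤s z≤n)

DegreeClassesComplete : Graph n → Set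
DegreeClassesComplete G = ∀ {i u v} → u ∈ D i G → v ∈ D i G → u ≢ v → adj G u v ≡ true

ClassesConnected : Graph n → Set
ClassesConnected G = ∀ i → (∃ λ v → v ∈ D i G) → InducedConnected G (D i G)

walk-source : ∀ {n} {G : Graph n} {S u v} → WalkIn G S u v → u ∈ S
walk-source (here u∈S)     = u∈S
walk-source (step u∈S _ _) = u∈S

walk-in-small-set⇒adjacent : ∀ {n} {G : Graph n} {S u v} → ∣ S ∣ ≤ 2 → v ∈ S → u ≢ v →
                             WalkIn G S u v → adj G u v ≡ true
walk-in-small-set⇒adjacent small v∈S u≢v (here _) = contradiction refl u≢v
walk-in-small-set⇒adjacent {G = G} {v = v} small v∈S u≢v (step {w = w} u∈S uw rest) with w ≟ v
... | yes refl = uw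
... | no  w≢v  = contradiction small (<⇒≱
  (distinct-triple⇒3≤∣p∣ u∈S v∈S (walk-source rest) u≢v (adjacent⇒≢ G uw) (w≢v ∘ sym)))

connected-small-classes⇒complete : ∀ {n} {G : Graph n} → (∀ i → ∣ D i G ∣ ≤ 2) → ClassesConnected G →
                                   DegreeClassesComplete G
connected-small-classes⇒complete small connected {i} u∈ v∈ u≢v =
  walk-in-small-set⇒adjacent (small i) v∈ u≢v (connected i (_ , u∈) _ _ u∈ v∈)

complete⇒connected : ∀ {n} {G : Graph n} → DegreeClassesComplete G → ∀ i → InducedConnected G (D i G)
complete⇒connected complete i u v u∈ v∈ with u ≟ v
... | yes refl = here u∈
... | no  u≢v  = step u∈ (complete u∈ v∈ u≢v) (here v∈)

α≡1⇒complete : ∀ {n k} {G : Graph n} → IsAlphaKReg k G 1 → DegreeClassesComplete G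
α≡1⇒complete {k = k} {G} α {u = u} {v} u∈ v∈ u≢v with adj G u v in uv
... | true  = refl
... | false = contradiction
  (pair⇒2≤α {G = G} α (Independent⇒KIndependent {G = G} k (nonadjacent-pair-independent {G = G} uv))
            u∈ v∈ u≢v)
  λ { (s≤s ()) }

complete⇒α≤1 : ∀ {n a} {G : Graph n} → DegreeClassesComplete G → IsAlphaKReg 0 G a → a ≤ 1
complete⇒α≤1 {G = G} complete ((S , (independent , i , in-class) , refl) , _) = subsingleton⇒∣p∣≤1 same
  where
  same : ∀ {x y} → x ∈ S → y ∈ S → x ≡ y
  same {x} {y} x∈ y∈ with x ≟ y
  ... | yes x≡y = x≡y
  ... | no  x≢y = contradiction (independent x x∈)
    (<⇒≱ (adjacent-member⇒0<degreeIn G y∈ (complete (in-class x x∈) (in-class y y∈) x≢y)))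

complete-class⇒independent : ∀ {n i S} {G H : Graph n} → Complementary G H → DegreeClassesComplete G →
                             (∀ {v} → v ∈ S → v ∈ D i G) → Independent H S
complete-class⇒independent c complete in-class u∈ v∈ u≢v =
  complementary-adj c u≢v (complete (in-class u∈) (in-class v∈) u≢v)

α≡1⇒k≡0 : ∀ {n k} {G : Graph n} → 2 ≤ n → IsAlphaKReg k G 1 → k ≡ 0
α≡1⇒k≡0 {k = zero}      _   _ = refl
α≡1⇒k≡0 {k = suc _} {G} 2≤n α with repeatedDegree 2≤n G
... | _ , u , v , u≢v , u∈ , v∈ = contradiction
  (pair⇒2≤α {G = G} α (KIndependent-mono {G = G} (s≤s z≤n) (pair-1-independent G u v)) u∈ v∈ u≢v)
  λ { (s≤s ()) }

α≡1⇒classes≤β : ∀ {n k b} {G H : Graph n} → Complementary G H → IsAlphaKReg k G 1 → IsAlphaKReg k H b →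
                ∀ i → ∣ D i G ∣ ≤ b × ∣ D i H ∣ ≤ b
α≡1⇒classes≤β {n} {k} {G = G} {H} c α (_ , maximal) i =
  maximal (D i G) (Independent⇒KIndependent {G = H} k (complete-class⇒independent c complete id) ,
                   n ∸ suc i , λ _ → ∈D-complementary c) ,
  maximal (D i H) (Independent⇒KIndependent {G = H} k
                     (complete-class⇒independent c complete (∈D-complementary (complementary-sym c))) ,
                   i , λ _ → id)
  where
  complete : DegreeClassesComplete G
  complete = α≡1⇒complete {G = G} α

complete⇒α≡1×β≡2 : ∀ {n a b} {G H : Graph n} → 2 ≤ n → Complementary G H → DegreeClassesComplete G →
                   (∀ i → ∣ D i H ∣ ≤ 2) → IsAlphaKReg 0 G a → IsAlphaKReg 0 H b → a ≡ 1 × b ≡ 2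
complete⇒α≡1×β≡2 {G = G} {H} 2≤n c complete small α β with repeatedDegree 2≤n G
... | _ , u , v , u≢v , u∈ , v∈ =
  ≤-antisym (complete⇒α≤1 {G = G} complete α) (0<α (≤-trans (s≤s z≤n) 2≤n) {G} α) ,
  ≤-antisym (classes≤m⇒α≤m {G = H} small β)
    (pair⇒2≤α {G = H} β (Independent⇒KIndependent {G = H} 0 (nonadjacent-pair-independent {G = H}
                           (complementary-adj c u≢v (complete u∈ v∈ u≢v))))
              (∈D-complementary c u∈) (∈D-complementary c v∈) u≢v)

sum≡3⊎product≡2 : ∀ {a b} → 0 < a → 0 < b → a + b ≡ 3 ⊎ a * b ≡ 2 → (a ≡ 1 × b ≡ 2) ⊎ (a ≡ 2 × b ≡ 1)
sum≡3⊎product≡2 {1} {1} _ _ (inj₁ ())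
sum≡3⊎product≡2 {1} {1} _ _ (inj₂ ())
sum≡3⊎product≡2 {1} {2} _ _ _ = inj₁ (refl , refl)
sum≡3⊎product≡2 {1} {suc (suc (suc _))} _ _ (inj₁ ())
sum≡3⊎product≡2 {1} {suc (suc (suc _))} _ _ (inj₂ ())
sum≡3⊎product≡2 {2} {1} _ _ _ = inj₂ (refl , refl)
sum≡3⊎product≡2 {2} {2} _ _ (inj₁ ())
sum≡3⊎product≡2 {2} {2} _ _ (inj₂ ())
sum≡3⊎product≡2 {2} {suc (suc (suc _))} _ _ (inj₁ ())
sum≡3⊎product≡2 {2} {suc (suc (suc _))} _ _ (inj₂ ())
sum≡3⊎product≡2 {suc (suc (suc a))} _ 0<b (inj₁ a+b≡3) =
  contradiction (sym a+b≡3) (<⇒≢ (+-mono-≤ (s≤s (s≤s (s≤s (z≤n {a})))) 0<b))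
sum≡3⊎product≡2 {suc (suc (suc a))} _ 0<b (inj₂ a*b≡2) =
  contradiction (sym a*b≡2) (<⇒≢ (*-mono-≤ (s≤s (s≤s (s≤s (z≤n {a})))) 0<b))

proposition6p1 : (n : ℕ) → 2 ≤ n → (k : ℕ) → (G : Graph n) → (a b : ℕ)
    → IsAlphaKReg k G a → IsAlphaKReg k (complement G) b
    → ((a + b ≡ 3 ⊎ a * b ≡ 2)
    ⇔ (k ≡ 0
    × (∀ i → ∣ D i G ∣ ≤ 2 × ∣ D i (complement G) ∣ ≤ 2)
    × ((∀ i → (∃ λ v → v ∈ D i G) → InducedConnected G (D i G))
    ⊎ (∀ j → (∃ λ v → v ∈ D j (complement G))
    → InducedConnected (complement G) (D j (complement G))))))
proposition6p1 n 2≤n k G a b α β = mk⇔ forward backward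
  where
  Ḡ : Graph n
  Ḡ = complement G
  c : Complementary G Ḡ
  c = complement-complementary G
  0<n : 0 < n
  0<n = ≤-trans (s≤s z≤n) 2≤n
  forward : a + b ≡ 3 ⊎ a * b ≡ 2 →
            k ≡ 0 × (∀ i → ∣ D i G ∣ ≤ 2 × ∣ D i Ḡ ∣ ≤ 2) × (ClassesConnected G ⊎ ClassesConnected Ḡ)
  forward values with sum≡3⊎product≡2 (0<α 0<n {G} α) (0<α 0<n {Ḡ} β) values
  ... | inj₁ (refl , refl) = α≡1⇒k≡0 {G = G} 2≤n α , α≡1⇒classes≤β c α β ,
                             inj₁ (λ i _ → complete⇒connected (α≡1⇒complete {G = G} α) i)
  ... | inj₂ (refl , refl) = α≡1⇒k≡0 {G = Ḡ} 2≤n β , swap ∘ α≡1⇒classes≤β (complementary-sym c) β α ,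
                             inj₂ (λ i _ → complete⇒connected (α≡1⇒complete {G = Ḡ} β) i)
  backward : k ≡ 0 × (∀ i → ∣ D i G ∣ ≤ 2 × ∣ D i Ḡ ∣ ≤ 2) × (ClassesConnected G ⊎ ClassesConnected Ḡ) →
             a + b ≡ 3 ⊎ a * b ≡ 2
  backward (refl , small , inj₁ connected)
    with complete⇒α≡1×β≡2 2≤n c (connected-small-classes⇒complete (proj₁ ∘ small) connected)
                          (proj₂ ∘ small) α β
  ... | refl , refl = inj₁ refl
  backward (refl , small , inj₂ connected)
    with complete⇒α≡1×β≡2 2≤n (complementary-sym c)
                          (connected-small-classes⇒complete (proj₂ ∘ small) connected) (proj₁ ∘ small) β α
  ... | refl , refl = inj₁ refl
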